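{- Let $X,Y$ be sets, $0\in X$ a distinguished element, and let $\mathcal{A}=(R,Q,E,\rho,\xi,\rhd)$ be an approximation algorithm of sort $X^\ast,X,Y$ which terminates. Let $\mathcal{F}_1$ be the set of all $\phi:X^{\mathbb{N}}\to\mathbb{N}$ such that for every $\gamma\in X^{\mathbb{N}}$ there is $N\in\mathbb{N}$ with $\phi(\overline{\gamma}N::\mathbf{0})<N$. Then for every $\phi_1\in\mathcal{F}_1$ and every $\phi_2:X^{\mathbb{N}}\to Y$, some end state of $\mathcal{A}_\omega$ is reachable in $\mathcal{A}_\omega$ on $\phi_1,\phi_2$ (i.e. $\mathcal{A}_\omega$ terminates on $\mathcal{F}_1$ and the full function space $X^{\mathbb{N}}\to Y$).
   Context: Notation: for a set $Z$, $Z^\ast$ is the set of finite sequences over $Z$, $[\,]$ the empty sequence, $|a|$ the length of $a$, $a::z$ (resp. $a::b$) extension by an element (resp. concatenation); for $\alpha\in Z^{\mathbb{N}}$, $\overline{\alpha}n:=[\alpha_0,\dots,\alpha_{n-1}]$; $\mathbf{0}$ is the constant sequence $0,0,\dots$. Approximation algorithm of sort $U,X,Y$: a tuple $(R,Q,E,\rho,\xi,\rhd)$ where $R$ is a set; states are pairs $\langle r\mid o\rangle$ with $r\in R$, $o\in Y\cup\{\Box\}$ ($\Box$ a fresh symbol); $Q\subseteq\{\langle r\mid\Box\rangle\}$ (query states); $E\subseteq\{\langle r\mid y\rangle: y\in Y\}$ (end states), $Q\cap E=\emptyset$; $\rho:U\to R$; $\xi:R\to X$; $\rhd$ a partial function on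 states such that if $\rhd(\langle r\mid o\rangle)=\langle r'\mid y\rangle$ with $y\in Y$ then $o=y$ and $\xi(r)=\xi(r')$. For an oracle $f:X\to Y$, a run on $f$ is a finite sequence $s_0,\dots,s_m$ with $s_i\notin E$ for $i<m$, $s_{i+1}=\langle r\mid f(\xi(r))\rangle$ if $s_i=\langle r\mid\Box\rangle\in Q$, and $s_{i+1}=\rhd(s_i)$ (defined) if $s_i\notin Q$. $\mathcal{A}$ terminates if for every $u\in U$ and every $f:X\to Y$ there is a run on $f$ from $\langle\rho(u)\mid\Box\rangle$ to a state in $E$. Construction of $\mathcal{A}_\omega$: states $\langle\sigma,a\mid o_1,o_2\rangle$ with $\sigma\in R^\ast$, $a\in X^\ast$, $o_1\in\mathbb{N}\cup\{\Box\}$, $o_2\in Y\cup\{\Box\}$; initial state $\langle[\rho([\,])],[\,]\mid\Box,\Box\rangle$; $Q_1$: states $\langle\sigma::r,[\,]\mid\Box,\Box\rangle$ with $\langle r\mid\Box\rangle\in Q$; $Q_2$: states $\langle\sigma,[\,]\mid n,\Box\rangle$ with $n\in\mathbb{N}$, $n<|\sigma|$; end states $E_\omega$: $\langle[\,],a\mid n,y\rangle$ with $n\in\mathbb{N},y\in Y$. $\xi^\ast$ applies $\xi$ componentwise and $\xi_\omega(\sigma,a):=\xi^\ast(\sigma)::a::\mathbf{0}$. Transitions $\rhd_\omega$: (a) $\langle\sigma,[\,]\mid n,\Box\rangle\rhd_\omega\langle\sigma::\rho(\xi^\ast(\sigma)),[\,]\mid\Box,\Box\rangle$ for $n\in\mathbb{N}$;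 (b) $\langle\sigma::r,a\mid n,y\rangle\rhd_\omega\langle\sigma,\xi(r)::a\mid n,y\rangle$ if $\langle r\mid y\rangle\in E$; (c) otherwise: (i) $\langle\sigma::r,[\,]\mid\Box,\Box\rangle\rhd_\omega\langle\sigma::r',[\,]\mid\Box,\Box\rangle$ if $\rhd(\langle r\mid\Box\rangle)=\langle r'\mid\Box\rangle$; (ii) $\langle\sigma::r,a\mid n,y\rangle\rhd_\omega\langle\sigma::r',[\,]\mid\Box,\Box\rangle$ if $\rhd(\langle r\mid y\rangle)=\langle r'\mid\Box\rangle$; (iii) $\langle\sigma::r,a\mid n,y\rangle\rhd_\omega\langle\sigma::r',a\mid n,y\rangle$ if $\rhd(\langle r\mid y\rangle)=\langle r'\mid y\rangle$. With oracles $\phi_1:X^{\mathbb{N}}\to\mathbb{N}$, $\phi_2:X^{\mathbb{N}}\to Y$, a state in $Q_1$ moves from $\langle\sigma,a\mid\Box,\Box\rangle$ to $\langle\sigma,a\mid\phi_1(\xi_\omega(\sigma,a)),\Box\rangle$, and a state in $Q_2$ moves from $\langle\sigma,a\mid n,\Box\rangle$ to $\langle\sigma,a\mid n,\phi_2(\xi_\omega(\sigma,a))\rangle$; all other states move by $\rhd_\omega$. A run is a finite sequence of such moves not passing through $E_\omega$ before its last element; a state is reachable if it is the last element of a run from the initial state. -}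

module Defs where

open import Data.Nat using (ℕ; zero; suc; _<_)
open import Data.List using (List; []; _∷_; _∷ʳ_; map; length; upTo; _++_)
open import Data.Maybe using (Maybe; just; nothing)
open import Data.Product using (Σ; _×_; _,_)
open import Data.Empty using (⊥)
open import Relation.Nullary using (¬_)
open import Relation.Binary.PropositionalEquality using (_≡_)

data Run {S : Set} (Step : S → S → Set) (End : S → Set) : S → S → Set where
  done : ∀ {s} → Run Step End s s
  step : ∀ {s s' t} → ¬ End s → Step s s' → Run Step End s' t → Run Step End s t

-- A state ⟨r ∣ o⟩ is a pair (r , o) with o : Maybe Y, where nothing
-- plays the role of the fresh symbol □.
-- Q r  means ⟨r ∣ □⟩ ∈ Q   (query states are exactly of this form);
-- E r y means ⟨r ∣ y⟩ ∈ E  (end states are exactly of this form);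
-- hence Q ∩ E = ∅ automatically.  ▷ is a partial function on states.

record ApproxAlg (U X Y : Set) : Set₁ where
  field
    R   : Set
    Q   : R → Set
    E   : R → Y → Set
    ρ   : U → R
    ξ   : R → X
    ▷   : R × Maybe Y → Maybe (R × Maybe Y)
    ▷-out : ∀ r o r' y → ▷ (r , o) ≡ just (r' , just y) → (o ≡ just y) × (ξ r ≡ ξ r')

  State : Set
  State = R × Maybe Y

  InQ : State → Set
  InQ (r , nothing) = Q r
  InQ (r , just _)  = ⊥

  InE : State → Set
  InE (r , nothing) = ⊥
  InE (r , just y)  = E r y

  data Step (f : X → Y) : State → State → Set where
    query : ∀ {r} → Q r → Step f (r , nothing) (r , just (f (ξ r)))
    trans : ∀ {s s'} → ¬ InQ s → ▷ s ≡ just s' → Step f s s'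

  RunOn : (X → Y) → State → State → Set
  RunOn f = Run (Step f) InE

Terminates : ∀ {U X Y} → ApproxAlg U X Y → Set
Terminates {U} {X} {Y} 𝒜 =
  (u : U) (f : X → Y) → Σ State λ t → RunOn f (ρ u , nothing) t × InE t
  where open ApproxAlg 𝒜

_++ˢ_ : ∀ {X : Set} → List X → (ℕ → X) → ℕ → X
[] ++ˢ α = α
(x ∷ a) ++ˢ α = λ { zero → x ; (suc n) → (a ++ˢ α) n }

𝟎 : ∀ {X : Set} → X → ℕ → X
𝟎 x₀ _ = x₀

initSeg : ∀ {X : Set} → (ℕ → X) → ℕ → List X
initSeg γ N = map γ (upTo N)

InF₁ : ∀ {X : Set} → X → ((ℕ → X) → ℕ) → Set
InF₁ {X} x₀ φ = (γ : ℕ → X) → Σ ℕ λ N → φ (initSeg γ N ++ˢ 𝟎 x₀) < N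

module Omega {X Y : Set} (x₀ : X) (𝒜 : ApproxAlg (List X) X Y) where
  open ApproxAlg 𝒜

  -- states ⟨σ , a ∣ o₁ , o₂⟩ ; σ :: r is written σ ∷ʳ r (extension at the end)
  record StateΩ : Set where
    constructor ⟨_,_∣_,_⟩
    field
      σ  : List R
      a  : List X
      o₁ : Maybe ℕ
      o₂ : Maybe Y

  init : StateΩ
  init = ⟨ ρ [] ∷ [] , [] ∣ nothing , nothing ⟩

  ξ* : List R → List X
  ξ* = map ξ

  ξω : List R → List X → ℕ → X
  ξω σ a = (ξ* σ ++ a) ++ˢ 𝟎 x₀

  data InQ₁ : StateΩ → Set where
    q₁ : ∀ {σ r} → Q r → InQ₁ ⟨ σ ∷ʳ r , [] ∣ nothing , nothing ⟩

  data InQ₂ : StateΩ → Set where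
    q₂ : ∀ {σ n} → n < length σ → InQ₂ ⟨ σ , [] ∣ just n , nothing ⟩

  data InEω : StateΩ → Set where
    endω : ∀ {a n y} → InEω ⟨ [] , a ∣ just n , just y ⟩

  data ▷ω : StateΩ → StateΩ → Set where
    ▷a   : ∀ {σ n} →
           ▷ω ⟨ σ , [] ∣ just n , nothing ⟩ ⟨ σ ∷ʳ ρ (ξ* σ) , [] ∣ nothing , nothing ⟩
    ▷b   : ∀ {σ r a n y} → E r y →
           ▷ω ⟨ σ ∷ʳ r , a ∣ just n , just y ⟩ ⟨ σ , ξ r ∷ a ∣ just n , just y ⟩
    ▷ci  : ∀ {σ r r'} → ▷ (r , nothing) ≡ just (r' , nothing) →
           ▷ω ⟨ σ ∷ʳ r , [] ∣ nothing , nothing ⟩ ⟨ σ ∷ʳ r' , [] ∣ nothing , nothing ⟩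
    ▷cii : ∀ {σ r r' a n y} → ¬ E r y → ▷ (r , just y) ≡ just (r' , nothing) →
           ▷ω ⟨ σ ∷ʳ r , a ∣ just n , just y ⟩ ⟨ σ ∷ʳ r' , [] ∣ nothing , nothing ⟩
    ▷ciii : ∀ {σ r r' a n y} → ¬ E r y → ▷ (r , just y) ≡ just (r' , just y) →
           ▷ω ⟨ σ ∷ʳ r , a ∣ just n , just y ⟩ ⟨ σ ∷ʳ r' , a ∣ just n , just y ⟩

  data StepΩ (φ₁ : (ℕ → X) → ℕ) (φ₂ : (ℕ → X) → Y) : StateΩ → StateΩ → Set where
    ask₁ : ∀ {σ a} → InQ₁ ⟨ σ , a ∣ nothing , nothing ⟩ →
           StepΩ φ₁ φ₂ ⟨ σ , a ∣ nothing , nothing ⟩ ⟨ σ , a ∣ just (φ₁ (ξω σ a)) , nothing ⟩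
    ask₂ : ∀ {σ a n} → InQ₂ ⟨ σ , a ∣ just n , nothing ⟩ →
           StepΩ φ₁ φ₂ ⟨ σ , a ∣ just n , nothing ⟩ ⟨ σ , a ∣ just n , just (φ₂ (ξω σ a)) ⟩
    move : ∀ {s s'} → ¬ InQ₁ s → ¬ InQ₂ s → ▷ω s s' → StepΩ φ₁ φ₂ s s'

  RunΩ : ((ℕ → X) → ℕ) → ((ℕ → X) → Y) → StateΩ → StateΩ → Set
  RunΩ φ₁ φ₂ = Run (StepΩ φ₁ φ₂) InEω

  ReachableΩ : ((ℕ → X) → ℕ) → ((ℕ → X) → Y) → StateΩ → Set
  ReachableΩ φ₁ φ₂ t = RunΩ φ₁ φ₂ init t

module Submission where

-- Termination of 𝒜_ω on 𝓕₁ × (X^ℕ → Y), proved by classical bar induction.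
--
-- Call p ∈ X* *secured* if the stack frame that 𝒜_ω pushes at level p (the
-- configuration ρ p on top of a stack σ with ξ* σ = p) eventually returns,
-- i.e. is popped again.
-- Hence the root [] is secured, and its run goes from the initial state of
-- 𝒜_ω to a state with empty stack, an end state.

open import Defs
open import Data.Nat using (ℕ)
open import Data.List using (List)
open import Data.Product using (Σ; _×_)
open import Level using (0ℓ)
open import Axiom.ExcludedMiddle using (ExcludedMiddle)

open import Data.Nat using (zero; suc; _<_; _<?_)
open import Data.List using ([]; _∷_; _∷ʳ_; map; length; upTo; [_])
open import Data.List.Properties using (map-++; length-map; length-applyUpTo; ++-identityʳ; ∷ʳ-injectiveʳ; upTo-∷ʳ)
open import Data.Maybe using (just; nothing)
open import Data.Product using (_,_; proj₁; proj₂)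
open import Function using (_∘_; id)
open import Relation.Nullary using (¬_; Dec; yes; no)
open import Relation.Binary.PropositionalEquality using (_≡_; refl; sym; trans; cong; cong₂; subst; subst₂; module ≡-Reasoning)
open import Axiom.DoubleNegationElimination using (em⇒dne)

_++ᴿ_ : ∀ {S : Set} {Step : S → S → Set} {End : S → Set} {s t u : S} →
        Run Step End s t → Run Step End t u → Run Step End s u
done ++ᴿ run₂ = run₂
step ¬end st run₁ ++ᴿ run₂ = step ¬end st (run₁ ++ᴿ run₂)

length-∷ʳ : ∀ {A : Set} (xs : List A) x → length (xs ∷ʳ x) ≡ suc (length xs)
length-∷ʳ [] x = refl
length-∷ʳ (_ ∷ xs) x = cong suc (length-∷ʳ xs x)

initSeg-suc : ∀ {X : Set} (γ : ℕ → X) n → initSeg γ (suc n) ≡ initSeg γ n ∷ʳ γ n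
initSeg-suc γ n = begin
  map γ (upTo (suc n))      ≡⟨ cong (map γ) (sym (upTo-∷ʳ n)) ⟩
  map γ (upTo n ∷ʳ n)       ≡⟨ map-++ γ (upTo n) [ n ] ⟩
  map γ (upTo n) ∷ʳ γ n     ∎
  where open ≡-Reasoning

length-initSeg : ∀ {X : Set} (γ : ℕ → X) n → length (initSeg γ n) ≡ n
length-initSeg γ n = trans (length-map γ (upTo n)) (length-applyUpTo (λ i → i) n)

module BarInduction (em : ExcludedMiddle 0ℓ) {X : Set}
                    (P : List X → Set) (Continue : List X → X → Set)
                    (progressive : ∀ p → (∀ x → Continue p x → P (p ∷ʳ x)) → P p) where

  Failing : Set
  Failing = Σ (List X) (¬_ ∘ P)

  -- A failing node has a failing admissible child (else it would be progressive).
  failing-child : ((p , _) : Failing) → Σ X λ x → Continue p x × ¬ P (p ∷ʳ x)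
  failing-child (p , ¬Pp) = em⇒dne em λ noChild →
    ¬Pp (progressive p λ x cont → em⇒dne em λ ¬Ppx → noChild (x , cont , ¬Ppx))

  descend : Failing → Failing
  descend node@(p , _) = let (x , _ , ¬Ppx) = failing-child node in p ∷ʳ x , ¬Ppx

  path : ¬ P [] → ℕ → Failing
  path ¬P[] zero = [] , ¬P[]
  path ¬P[] (suc n) = descend (path ¬P[] n)

  branch : ¬ P [] → ℕ → X
  branch ¬P[] n = proj₁ (failing-child (path ¬P[] n))

  initSeg-branch : ∀ ¬P[] n → initSeg (branch ¬P[]) n ≡ proj₁ (path ¬P[] n)
  initSeg-branch ¬P[] zero = refl
  initSeg-branch ¬P[] (suc n) =
    trans (initSeg-suc (branch ¬P[]) n) (cong (_∷ʳ branch ¬P[] n) (initSeg-branch ¬P[] n))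

  branch-continues : ∀ ¬P[] n → Continue (initSeg (branch ¬P[]) n) (branch ¬P[] n)
  branch-continues ¬P[] n =
    subst (λ p → Continue p (branch ¬P[] n)) (sym (initSeg-branch ¬P[] n))
          (proj₁ (proj₂ (failing-child (path ¬P[] n))))

  -- The branch would violate the bar hypothesis, so P [] cannot fail.
  bar-induction : (∀ γ → Σ ℕ λ k → ¬ Continue (initSeg γ k) (γ k)) → P []
  bar-induction bar = em⇒dne em λ ¬P[] →
    let (k , stops) = bar (branch ¬P[]) in stops (branch-continues ¬P[] k)

module Probing {X : Set} (x₀ : X) (φ₁ : (ℕ → X) → ℕ) where

  -- The point ξ_ω at which the oracles are asked when the top frame, at
  -- level p, queries x; and whether φ₁ then stops (the Q₂ condition).
  probe : List X → X → ℕ → X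
  probe p x = (p ∷ʳ x) ++ˢ 𝟎 x₀

  Stops : List X → X → Set
  Stops p x = φ₁ (probe p x) < suc (length p)

  Stops? : ∀ p x → Dec (Stops p x)
  Stops? p x = φ₁ (probe p x) <? suc (length p)

  F₁⇒bar : InF₁ x₀ φ₁ → ∀ γ → Σ ℕ λ k → ¬ ¬ Stops (initSeg γ k) (γ k)
  F₁⇒bar F γ with F γ
  ... | suc k , lt = k , λ ¬stops → ¬stops (subst₂ _<_
          (cong (λ l → φ₁ (l ++ˢ 𝟎 x₀)) (initSeg-suc γ k))
          (cong suc (sym (length-initSeg γ k))) lt)

module Frames {X Y : Set} (x₀ : X) (𝒜 : ApproxAlg (List X) X Y)
              (φ₁ : (ℕ → X) → ℕ) (φ₂ : (ℕ → X) → Y) where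
  open ApproxAlg 𝒜 renaming (trans to ▷-step)
  open Omega x₀ 𝒜
  open Probing x₀ φ₁

  -- The top frame of a stack σ ∷ʳ r: either 𝒜 is computing without an
  -- answer, or it holds the answer (a , n , y) returned by the frame above.
  data Frame : Set where
    running  : R → Frame
    answered : R → List X → ℕ → Y → Frame

  frameState : List R → Frame → StateΩ
  frameState σ (running r) = ⟨ σ ∷ʳ r , [] ∣ nothing , nothing ⟩
  frameState σ (answered r a n y) = ⟨ σ ∷ʳ r , a ∣ just n , just y ⟩

  Result : Set
  Result = List X × ℕ × Y

  resultState : List R → Result → StateΩ
  resultState σ (a , n , y) = ⟨ σ , a ∣ just n , just y ⟩

  -- Returns p fr res : the top frame fr at level p returns res.  Each
  -- constructor is one kind of move of 𝒜_ω; `descend` pushes a new frame.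
  data Returns (p : List X) : Frame → Result → Set where
    pop     : ∀ {r a n y} → E r y → Returns p (answered r a n y) (ξ r ∷ a , n , y)
    silent  : ∀ {r r' res} → ¬ Q r → ▷ (r , nothing) ≡ just (r' , nothing) →
              Returns p (running r') res → Returns p (running r) res
    stop    : ∀ {r res} → Q r → Stops p (ξ r) →
              Returns p (answered r [] (φ₁ (probe p (ξ r))) (φ₂ (probe p (ξ r)))) res →
              Returns p (running r) res
    descend : ∀ {r a n y res} → Q r → ¬ Stops p (ξ r) →
              Returns (p ∷ʳ ξ r) (running (ρ (p ∷ʳ ξ r))) (a , n , y) →
              Returns p (answered r a n y) res → Returns p (running r) res
    resume  : ∀ {r r' a n y res} → ¬ E r y → ▷ (r , just y) ≡ just (r' , nothing) →
              Returns p (running r') res → Returns p (answered r a n y) res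
    keep    : ∀ {r r' a n y res} → ¬ E r y → ▷ (r , just y) ≡ just (r' , just y) →
              Returns p (answered r' a n y) res → Returns p (answered r a n y) res

  ¬end : ∀ {σ r a o₁ o₂} → ¬ InEω ⟨ σ ∷ʳ r , a ∣ o₁ , o₂ ⟩
  ¬end {[]} ()
  ¬end {_ ∷ _} ()

  ¬Q₁-answered : ∀ {σ a n o} → ¬ InQ₁ ⟨ σ , a ∣ just n , o ⟩
  ¬Q₁-answered ()

  Q₁-top : ∀ {s σ r} → InQ₁ s → StateΩ.σ s ≡ σ ∷ʳ r → Q r
  Q₁-top {σ = σ} (q₁ {σ'} q) eq = subst Q (∷ʳ-injectiveʳ σ' σ eq) q

  ¬Q₁-running : ∀ {σ r} → ¬ Q r → ¬ InQ₁ ⟨ σ ∷ʳ r , [] ∣ nothing , nothing ⟩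
  ¬Q₁-running ¬q q = ¬q (Q₁-top q refl)

  ¬Q₂-answered : ∀ {σ a o y} → ¬ InQ₂ ⟨ σ , a ∣ o , just y ⟩
  ¬Q₂-answered ()

  ¬Q₂-running : ∀ {σ a o} → ¬ InQ₂ ⟨ σ , a ∣ nothing , o ⟩
  ¬Q₂-running ()

  ¬Q₂-deep : ∀ {σ n} → ¬ n < length σ → ¬ InQ₂ ⟨ σ , [] ∣ just n , nothing ⟩
  ¬Q₂-deep ¬lt (q₂ lt) = ¬lt lt

  ξ*-∷ʳ : ∀ σ r → ξ* (σ ∷ʳ r) ≡ ξ* σ ∷ʳ ξ r
  ξ*-∷ʳ σ r = map-++ ξ σ [ r ]

  ξω-top : ∀ σ r → ξω (σ ∷ʳ r) [] ≡ probe (ξ* σ) (ξ r)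
  ξω-top σ r = cong (_++ˢ 𝟎 x₀) (trans (++-identityʳ (ξ* (σ ∷ʳ r))) (ξ*-∷ʳ σ r))

  stops-top : ∀ σ r → Stops (ξ* σ) (ξ r) ≡ (φ₁ (ξω (σ ∷ʳ r) []) < length (σ ∷ʳ r))
  stops-top σ r = cong₂ _<_ (cong φ₁ (sym (ξω-top σ r)))
                            (trans (cong suc (length-map ξ σ)) (sym (length-∷ʳ σ r)))

  returns⇒run : ∀ {p fr res} → Returns p fr res → (σ : List R) → ξ* σ ≡ p →
                RunΩ φ₁ φ₂ (frameState σ fr) (resultState σ res)
  returns⇒run (pop e) σ refl = step ¬end (move ¬Q₁-answered ¬Q₂-answered (▷b e)) done
  returns⇒run (silent ¬q eq ret) σ refl =
    step ¬end (move (¬Q₁-running ¬q) ¬Q₂-running (▷ci eq)) (returns⇒run ret σ refl)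
  returns⇒run (resume ¬e eq ret) σ refl =
    step ¬end (move ¬Q₁-answered ¬Q₂-answered (▷cii ¬e eq)) (returns⇒run ret σ refl)
  returns⇒run (keep ¬e eq ret) σ refl =
    step ¬end (move ¬Q₁-answered ¬Q₂-answered (▷ciii ¬e eq)) (returns⇒run ret σ refl)
  returns⇒run (stop {r} {res} q stops ret) σ refl =
    step ¬end (ask₁ (q₁ q)) (step ¬end (ask₂ (q₂ (subst id (stops-top σ r) stops)))
      (subst (λ v → RunΩ φ₁ φ₂ ⟨ σ ∷ʳ r , [] ∣ just (φ₁ v) , just (φ₂ v) ⟩ (resultState σ res))
             (sym (ξω-top σ r)) (returns⇒run ret σ refl)))
  returns⇒run (descend {r} {a} {n} {y} q ¬stops child ret) σ refl =
    step ¬end (ask₁ (q₁ q)) (step ¬end (move ¬Q₁-answered (¬Q₂-deep ¬stops') ▷a)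
      (childRun ++ᴿ returns⇒run ret σ refl))
    where
      ¬stops' : ¬ φ₁ (ξω (σ ∷ʳ r) []) < length (σ ∷ʳ r)
      ¬stops' stops = ¬stops (subst id (sym (stops-top σ r)) stops)
      childRun : RunΩ φ₁ φ₂ (frameState (σ ∷ʳ r) (running (ρ (ξ* (σ ∷ʳ r)))))
                            (resultState (σ ∷ʳ r) (a , n , y))
      childRun = subst (λ p → RunΩ φ₁ φ₂ (frameState (σ ∷ʳ r) (running (ρ p)))
                                  (resultState (σ ∷ʳ r) (a , n , y)))
                       (sym (ξ*-∷ʳ σ r)) (returns⇒run child (σ ∷ʳ r) (ξ*-∷ʳ σ r))

  Secured : List X → Set
  Secured p = Σ Result (Returns p (running (ρ p)))

  -- Replaying 𝒜 at level p against the oracle formed by the answers that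
  -- 𝒜_ω gives to queries at level p, assuming the deeper children return.
  module AtLevel (p : List X) (children : ∀ x → ¬ Stops p x → Secured (p ∷ʳ x)) where

    answer : ∀ x → Dec (Stops p x) → Y
    answer x (yes _) = φ₂ (probe p x)
    answer x (no ¬stops) = let ((_ , _ , y) , _) = children x ¬stops in y

    oracle : X → Y
    oracle x = answer x (Stops? p x)

    -- The frame-level meaning of a state of 𝒜 (an answered state may carry
    -- any values a , n returned from above).
    Returning : State → Set
    Returning (r , nothing) = Σ Result (Returns p (running r))
    Returning (r , just y) = ∀ a n → Σ Result (Returns p (answered r a n y))

    query-returns : ∀ {r} → Q r → Returning (r , just (oracle (ξ r))) → Returning (r , nothing)
    query-returns {r} q continue with Stops? p (ξ r)
    ... | yes stops = let (res , ret) = continue [] _ in res , stop q stops ret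
    ... | no ¬stops =
      let ((a , n , y) , child) = children (ξ r) ¬stops
          (res , ret) = continue a n
      in res , descend q ¬stops child ret

    run⇒returning : ∀ {s t} → RunOn oracle s t → InE t → Returning s
    run⇒returning {r , just y} done e = λ a n → _ , pop e
    run⇒returning (step _ (query q) run) e = query-returns q (run⇒returning run e)
    run⇒returning {r , nothing} (step {s' = r' , nothing} _ (▷-step ¬q eq) run) e =
      let (res , ret) = run⇒returning run e in res , silent ¬q eq ret
    run⇒returning {r , nothing} (step {s' = r' , just y} _ (▷-step _ eq) _) _
      with ▷-out r nothing r' y eq
    ... | () , _
    run⇒returning {r , just y} (step {s' = r' , nothing} ¬e (▷-step _ eq) run) e =
      λ a n → let (res , ret) = run⇒returning run e in res , resume ¬e eq ret
    run⇒returning {r , just y} (step {s' = r' , just y'} ¬e (▷-step _ eq) run) e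
      with ▷-out r (just y) r' y' eq
    ... | refl , _ = λ a n → let (res , ret) = run⇒returning run e a n in res , keep ¬e eq ret

  secured-progressive : Terminates 𝒜 → ∀ p → (∀ x → ¬ Stops p x → Secured (p ∷ʳ x)) → Secured p
  secured-progressive term p children =
    let (_ , run , end) = term p oracle in run⇒returning run end
    where open AtLevel p children

theorem5p13 : ExcludedMiddle 0ℓ →
    {X Y : Set} (x₀ : X) (𝒜 : ApproxAlg (List X) X Y) → Terminates 𝒜 →
    (φ₁ : (ℕ → X) → ℕ) → InF₁ x₀ φ₁ → (φ₂ : (ℕ → X) → Y) →
    Σ (Omega.StateΩ x₀ 𝒜) (λ t → Omega.ReachableΩ x₀ 𝒜 φ₁ φ₂ t × Omega.InEω x₀ 𝒜 t)
theorem5p13 em x₀ 𝒜 term φ₁ F φ₂ =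
  let
      (_ , rootReturns) = bar-induction em Secured (λ p x → ¬ Stops p x)
                            (secured-progressive term) (F₁⇒bar F)
  in _ , returns⇒run rootReturns [] refl , Omega.endω
  where
    open BarInduction using (bar-induction)
    open Probing x₀ φ₁ using (Stops; F₁⇒bar)
    open Frames x₀ 𝒜 φ₁ φ₂
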